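{- Let $k\ge 1$ be an integer and let $n$ be an odd positive integer with $\sigma(n)=2^k n$. Write $n={\Pi}M^2$ where ${\Pi}$ is the Euler part of $n$. Suppose all prime factors of $M$ are $\equiv 3\pmod 4$, and ${\Pi}=p_1^{e_1}\cdots p_s^{e_s}q_1^{f_1}\cdots q_{2t}^{f_{2t}}$ with distinct primes $p_i\equiv 1\pmod 4$, distinct primes $q_j\equiv 3\pmod 4$, an integer $t\ge 0$ (so the number of primes $\equiv 3 \pmod 4$ dividing ${\Pi}$ is even), and $\gcd(\sigma({\Pi}),p_1\cdots p_s)=1$. Then $$\Omega\!\left(\frac{\sigma({\Pi})}{2^k}\right)\equiv 0\pmod 2.$$
   Context: $\sigma(m)$ denotes the sum of the positive divisors of $m$. For an odd positive integer $n$, its Euler part ${\Pi}$ is the product of all prime powers $p^e$ with $p^e\parallel n$ (i.e. $p^e\mid n$, $p^{e+1}\nmid n$) and $e$ odd; thus $n={\Pi}M^2$ with $\gcd({\Pi},M)=1$ (so the exponents $e_i,f_j$ above are odd). $\Omega(m)$ denotes the total number of prime factors of $m$ counted with multiplicity. -}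

module Defs where

open import Data.Nat using (ℕ; zero; suc; _+_; _*_; _^_; _≤_; _/_; _%_; NonZero; >-nonZero)
open import Data.Nat.Properties using (m^n>0)
open import Data.Nat.Divisibility using (_∣_; _∣?_)
open import Data.Nat.Primality using (Prime; prime?)
open import Data.List using (List; length; filter; applyUpTo; map)
open import Data.Nat.ListAction using (sum; product)
open import Relation.Binary.PropositionalEquality using (_≡_)
open import Data.Product using (_×_; _,_)
open import Relation.Nullary using (¬_)

[1‥_] : ℕ → List ℕ
[1‥ m ] = applyUpTo suc m

σ : ℕ → ℕ
σ m = sum (filter (_∣? m) [1‥ m ])

-- p-adic valuation of m (for p ≥ 2 and m ≥ 1):
-- the number of e ∈ {1,…,m} with p^e ∣ m
val : ℕ → ℕ → ℕ
val p m = length (filter (λ e → (p ^ e) ∣? m) [1‥ m ])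

Ω : ℕ → ℕ
Ω m = sum (map (λ p → val p m) (filter prime? [1‥ m ]))

_^_∥_ : ℕ → ℕ → ℕ → Set
p ^ e ∥ n = (p ^ e) ∣ n × ¬ ((p ^ suc e) ∣ n)

Odd : ℕ → Set
Odd n = n % 2 ≡ 1

IsEulerPart : ℕ → ℕ → Set
IsEulerPart n Π =
  1 ≤ Π ×
  (∀ p e → Prime p → 1 ≤ e →
     ((p ^ e ∥ Π → (p ^ e ∥ n) × Odd e) × ((p ^ e ∥ n) × Odd e → p ^ e ∥ Π)))

_/2^_ : ℕ → ℕ → ℕ
x /2^ k = _/_ x (2 ^ k) {{>-nonZero (m^n>0 2 k)}}

ppow : ℕ × ℕ → ℕ
ppow (p , e) = p ^ e

{-# OPTIONS --safe #-}
-- Π and M² are coprime, since a prime power exactly dividing Π exactly divides n; so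
-- σ(n) = σ(Π) σ(M²).  Every prime power in M² is q^(2j) with q ≡ 3 (mod 4), and
-- σ(q^(2j)) = 1 + q + ⋯ + q^(2j) ≡ 1 (mod 4), so σ(M²) ≡ 1 (mod 4).  Hence σ(M²) is odd,
-- 2^k divides σ(Π), and m = σ(Π)/2^k satisfies m σ(M²) = n; in particular m ≡ n ≡ Π M² ≡ 1
-- (mod 4), as the q_j occur with odd exponents and in even number.  A prime factor of m
-- divides both σ(Π) and n, so by gcd(σ(Π), p₁⋯pₛ) = 1 it is some q_j or divides M, hence is
-- ≡ 3 (mod 4).  Being ≡ 3^Ω(m) (mod 4) and ≡ 1 (mod 4), m has Ω(m) even.
module Submission where

open import Defs
open import Data.Nat
open import Data.Nat.Properties
open import Data.Nat.DivMod
open import Data.Nat.Divisibility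
open import Data.Nat.Primality
open import Data.Nat.Primality.Factorisation using (PrimeFactorisation; factorise)
open import Data.Nat.Coprimality using (Coprime; coprime-divisor)
open import Data.Nat.GCD using (gcd; gcd-greatest)
open import Data.Nat.Induction using (<-rec)
open import Data.Nat.ListAction using (sum; product)
open import Data.Nat.ListAction.Properties using (sum-++; product-++; ∈⇒∣product)
open import Data.List using (List; []; _∷_; length; map; filter; applyUpTo; _++_)
open import Data.List.Properties using (applyUpTo-∷ʳ; filter-++; map-++; map-id; length-map)
open import Data.List.Membership.Propositional using (_∈_)
open import Data.List.Relation.Unary.All as All using (All; []; _∷_)
open import Data.List.Relation.Unary.All.Properties using (map⁺; map⁻; All¬⇒¬Any) renaming (++⁺ to All-++⁺)
open import Data.List.Relation.Unary.Any using (Any; here; there)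
open import Data.List.Relation.Unary.Any.Properties using () renaming (++⁻ to Any-++⁻; map⁺ to Any-map⁺)
open import Data.List.Membership.Propositional.Properties using (∈-++⁺ʳ)
open import Data.List.Relation.Unary.Unique.Propositional using (Unique)
open import Data.List.Relation.Unary.AllPairs using (_∷_)
open import Data.Product using (∃; ∃₂; _×_; _,_; proj₁; proj₂)
open import Data.Sum using (_⊎_; inj₁; inj₂; [_,_]′)
open import Data.Empty using (⊥; ⊥-elim)
open import Function using (id; _∘_; case_of_)
open import Level using (0ℓ)
open import Relation.Nullary using (¬_; yes; no; ¬?)
open import Relation.Unary using (Pred; Decidable)
open import Relation.Binary.PropositionalEquality
open ≡-Reasoning

import Algebra.Properties.CommutativeSemigroup as CommSemigroupProperties
private
  module +-CS = CommSemigroupProperties +-commutativeSemigroup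
  module *-CS = CommSemigroupProperties *-commutativeSemigroup

-- Finite sums

∑< : ℕ → (ℕ → ℕ) → ℕ
∑< zero    f = 0
∑< (suc n) f = ∑< n f + f n

syntax ∑< n (λ i → e) = ∑[ i < n ] e

∑<-cong : ∀ n {f g : ℕ → ℕ} → (∀ i → i < n → f i ≡ g i) → ∑< n f ≡ ∑< n g
∑<-cong zero    eq = refl
∑<-cong (suc n) eq = cong₂ _+_ (∑<-cong n (λ i i<n → eq i (m<n⇒m<1+n i<n))) (eq n ≤-refl)

∑<-zero : ∀ n {f : ℕ → ℕ} → (∀ i → i < n → f i ≡ 0) → ∑< n f ≡ 0
∑<-zero zero    eq = refl
∑<-zero (suc n) eq = cong₂ _+_ (∑<-zero n (λ i i<n → eq i (m<n⇒m<1+n i<n))) (eq n ≤-refl)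

∑<-1 : ∀ n → ∑[ i < n ] 1 ≡ n
∑<-1 zero    = refl
∑<-1 (suc n) = trans (cong (_+ 1) (∑<-1 n)) (+-comm n 1)

∑<-+ : ∀ n (f g : ℕ → ℕ) → ∑[ i < n ] (f i + g i) ≡ ∑< n f + ∑< n g
∑<-+ zero    f g = refl
∑<-+ (suc n) f g =
  trans (cong (_+ (f n + g n)) (∑<-+ n f g)) (+-CS.interchange (∑< n f) (∑< n g) (f n) (g n))

∑<-*ˡ : ∀ n c (f : ℕ → ℕ) → ∑[ i < n ] (c * f i) ≡ c * ∑< n f
∑<-*ˡ zero    c f = sym (*-zeroʳ c)
∑<-*ˡ (suc n) c f =
  trans (cong (_+ c * f n) (∑<-*ˡ n c f)) (sym (*-distribˡ-+ c (∑< n f) (f n)))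

∑<-+-split : ∀ a b (f : ℕ → ℕ) → ∑< (a + b) f ≡ ∑< a f + ∑[ i < b ] f (a + i)
∑<-+-split a zero    f = trans (cong (λ n → ∑< n f) (+-identityʳ a)) (sym (+-identityʳ _))
∑<-+-split a (suc b) f = begin
  ∑< (a + suc b) f                                  ≡⟨ cong (λ n → ∑< n f) (+-suc a b) ⟩
  ∑< (a + b) f + f (a + b)                          ≡⟨ cong (_+ f (a + b)) (∑<-+-split a b f) ⟩
  ∑< a f + ∑[ i < b ] f (a + i) + f (a + b)         ≡⟨ +-assoc (∑< a f) _ _ ⟩
  ∑< a f + (∑[ i < b ] f (a + i) + f (a + b))       ∎

∑<-truncate : ∀ {a N} (f : ℕ → ℕ) → a ≤ N → (∀ i → a ≤ i → f i ≡ 0) → ∑< N f ≡ ∑< a f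
∑<-truncate {a} {N} f a≤N vanish = begin
  ∑< N f                                ≡⟨ cong (λ n → ∑< n f) (sym (m+[n∸m]≡n a≤N)) ⟩
  ∑< (a + (N ∸ a)) f                    ≡⟨ ∑<-+-split a (N ∸ a) f ⟩
  ∑< a f + ∑[ i < N ∸ a ] f (a + i)     ≡⟨ cong (∑< a f +_) (∑<-zero (N ∸ a) (λ i _ → vanish (a + i) (m≤m+n a i))) ⟩
  ∑< a f + 0                            ≡⟨ +-identityʳ _ ⟩
  ∑< a f                                ∎

∑<-stride : ∀ r N (h : ℕ → ℕ) .{{_ : NonZero r}} → (∀ d → ¬ r ∣ d → h d ≡ 0) →
  ∑[ i < r * N ] h (suc i) ≡ ∑[ i < N ] h (r * suc i)
∑<-stride r zero    h vanish = cong (λ n → ∑[ i < n ] h (suc i)) (*-zeroʳ r)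
∑<-stride r@(suc r′) (suc N) h vanish = begin
  ∑[ i < r * suc N ] h (suc i)                                ≡⟨ cong (λ n → ∑[ i < n ] h (suc i)) (*-suc r N) ⟩
  ∑[ i < r + r * N ] h (suc i)                                ≡⟨ cong (λ n → ∑[ i < n ] h (suc i)) (+-comm r (r * N)) ⟩
  ∑[ i < r * N + suc r′ ] h (suc i)                           ≡⟨ ∑<-+-split (r * N) r h′ ⟩
  ∑< (r * N) h′ + (∑[ i < r′ ] h′ (r * N + i) + h′ (r * N + r′))
      ≡⟨ cong₂ (λ x y → x + (y + h′ (r * N + r′))) (∑<-stride r N h vanish) (∑<-zero r′ gap) ⟩
  ∑[ i < N ] h (r * suc i) + h (suc (r * N + r′))             ≡⟨ cong (λ d → ∑[ i < N ] h (r * suc i) + h d) last ⟩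
  ∑[ i < N ] h (r * suc i) + h (r * suc N)                    ∎
  where
  h′ : ℕ → ℕ
  h′ i = h (suc i)
  gap : ∀ i → i < r′ → h′ (r * N + i) ≡ 0
  gap i i<r′ = vanish _ λ r∣ → <⇒≱ (s≤s i<r′)
    (∣⇒≤ (∣m+n∣m⇒∣n (subst (r ∣_) (sym (+-suc (r * N) i)) r∣) (m∣m*n N)))
  last : suc (r * N + r′) ≡ r * suc N
  last = trans (sym (+-suc (r * N) r′)) (trans (+-comm (r * N) r) (sym (*-suc r N)))

restrict : {P : Pred ℕ 0ℓ} → Decidable P → (ℕ → ℕ) → ℕ → ℕ
restrict P? g d with P? d
... | yes _ = g d
... | no  _ = 0

module _ {P : Pred ℕ 0ℓ} (P? : Decidable P) (g : ℕ → ℕ) where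

  restrict-yes : ∀ {d} → P d → restrict P? g d ≡ g d
  restrict-yes {d} p with P? d
  ... | yes _ = refl
  ... | no ¬p = ⊥-elim (¬p p)

  restrict-no : ∀ {d} → ¬ P d → restrict P? g d ≡ 0
  restrict-no {d} ¬p with P? d
  ... | yes p = ⊥-elim (¬p p)
  ... | no _  = refl

  restrict-cong : ∀ {Q : Pred ℕ 0ℓ} (Q? : Decidable Q) d →
    (P d → Q d) → (Q d → P d) → restrict P? g d ≡ restrict Q? g d
  restrict-cong Q? d P⇒Q Q⇒P with P? d | Q? d
  ... | yes _ | yes _ = refl
  ... | no  _ | no  _ = refl
  ... | yes p | no ¬q = ⊥-elim (¬q (P⇒Q p))
  ... | no ¬p | yes q = ⊥-elim (¬p (Q⇒P q))

  restrict-split : ∀ d → g d ≡ restrict P? g d + restrict (¬? ∘ P?) g d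
  restrict-split d with P? d
  ... | yes _ = sym (+-identityʳ (g d))
  ... | no  _ = refl

  sum-map-filter-applyUpTo : ∀ f n →
    sum (map g (filter P? (applyUpTo f n))) ≡ ∑[ i < n ] restrict P? g (f i)
  sum-map-filter-applyUpTo f zero    = refl
  sum-map-filter-applyUpTo f (suc n) = begin
    sum (map g (filter P? (applyUpTo f (suc n))))
      ≡⟨ cong (λ xs → sum (map g (filter P? xs))) (sym (applyUpTo-∷ʳ f n)) ⟩
    sum (map g (filter P? (applyUpTo f n ++ f n ∷ [])))
      ≡⟨ cong (λ xs → sum (map g xs)) (filter-++ P? (applyUpTo f n) (f n ∷ [])) ⟩
    sum (map g (filter P? (applyUpTo f n) ++ filter P? (f n ∷ [])))
      ≡⟨ cong sum (map-++ g (filter P? (applyUpTo f n)) _) ⟩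
    sum (map g (filter P? (applyUpTo f n)) ++ map g (filter P? (f n ∷ [])))
      ≡⟨ sum-++ (map g (filter P? (applyUpTo f n))) _ ⟩
    sum (map g (filter P? (applyUpTo f n))) + sum (map g (filter P? (f n ∷ [])))
      ≡⟨ cong₂ _+_ (sum-map-filter-applyUpTo f n) singleton ⟩
    ∑[ i < n ] restrict P? g (f i) + restrict P? g (f n) ∎
    where
    singleton : sum (map g (filter P? (f n ∷ []))) ≡ restrict P? g (f n)
    singleton with P? (f n)
    ... | yes _ = +-identityʳ (g (f n))
    ... | no  _ = refl

length≡sum-map-1 : ∀ {A : Set} (xs : List A) → length xs ≡ sum (map (λ _ → 1) xs)
length≡sum-map-1 []       = refl
length≡sum-map-1 (x ∷ xs) = cong suc (length≡sum-map-1 xs)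

divisorTerm : ℕ → ℕ → ℕ
divisorTerm m = restrict (_∣? m) id

σ≡∑ : ∀ m → σ m ≡ ∑[ i < m ] divisorTerm m (suc i)
σ≡∑ m = trans (cong sum (sym (map-id (filter (_∣? m) [1‥ m ])))) (sum-map-filter-applyUpTo (_∣? m) id suc m)

val≡∑ : ∀ p m → val p m ≡ ∑[ i < m ] restrict (λ e → p ^ e ∣? m) (λ _ → 1) (suc i)
val≡∑ p m = trans (length≡sum-map-1 (filter (λ e → p ^ e ∣? m) [1‥ m ]))
  (sum-map-filter-applyUpTo (λ e → p ^ e ∣? m) (λ _ → 1) suc m)

Ω≡∑ : ∀ m → Ω m ≡ ∑[ i < m ] restrict prime? (λ q → val q m) (suc i)
Ω≡∑ m = sum-map-filter-applyUpTo prime? (λ q → val q m) suc m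

-- Primes and prime powers

prime⇒2≤ : ∀ {p} → Prime p → 2 ≤ p
prime⇒2≤ {p} pp = nonTrivial⇒n>1 p {{prime⇒nonTrivial pp}}

¬prime∣1 : ∀ {q} → Prime q → ¬ q ∣ 1
¬prime∣1 pq q∣1 = ¬prime[1] (subst Prime (∣1⇒≡1 q∣1) pq)

prime∣prime⇒≡ : ∀ {q p} → Prime q → Prime p → q ∣ p → q ≡ p
prime∣prime⇒≡ pq pp q∣p with prime⇒irreducible pp q∣p
... | inj₁ refl = ⊥-elim (¬prime[1] pq)
... | inj₂ q≡p  = q≡p

prime∣^⇒∣ : ∀ {q} p e → Prime q → q ∣ p ^ e → q ∣ p
prime∣^⇒∣ p zero    pq q∣1 = ⊥-elim (¬prime∣1 pq q∣1)
prime∣^⇒∣ p (suc e) pq q∣  = [ id , prime∣^⇒∣ p e pq ]′ (euclidsLemma p (p ^ e) pq q∣)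

prime∤* : ∀ {q a b} → Prime q → ¬ q ∣ a → ¬ q ∣ b → ¬ q ∣ a * b
prime∤* {a = a} {b} pq q∤a q∤b q∣ab = [ q∤a , q∤b ]′ (euclidsLemma a b pq q∣ab)

∃primeDivisor : ∀ {n} → 2 ≤ n → ∃ λ p → Prime p × p ∣ n
∃primeDivisor {n@(suc _)} 2≤n with factorise n
... | record { factors = [] ; isFactorisation = n≡1 } = ⊥-elim (<⇒≢ 2≤n (sym n≡1))
... | record { factors = p ∷ ps ; isFactorisation = n≡ ; factorsPrime = pp ∷ _ } =
  p , pp , subst (p ∣_) (sym n≡) (m∣m*n (product ps))

noCommonPrime⇒coprime : ∀ {a b} → 1 ≤ a → (∀ s → Prime s → s ∣ a → s ∣ b → ⊥) → Coprime a b
noCommonPrime⇒coprime {a} 1≤a noCommon {zero} (0∣a , _) = ⊥-elim (<⇒≢ 1≤a (sym (0∣⇒≡0 0∣a)))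
noCommonPrime⇒coprime 1≤a noCommon {suc zero} _ = refl
noCommonPrime⇒coprime 1≤a noCommon {c@(suc (suc _))} (c∣a , c∣b) =
  let s , ps , s∣c = ∃primeDivisor {c} (s≤s (s≤s z≤n))
  in  ⊥-elim (noCommon s ps (∣-trans s∣c c∣a) (∣-trans s∣c c∣b))

^-monoʳ-∣ : ∀ q {a b} → a ≤ b → q ^ a ∣ q ^ b
^-monoʳ-∣ q {a} {b} a≤b = divides (q ^ (b ∸ a)) (begin
  q ^ b             ≡⟨ cong (q ^_) (sym (m∸n+n≡m a≤b)) ⟩
  q ^ (b ∸ a + a)   ≡⟨ ^-distribˡ-+-* q (b ∸ a) a ⟩
  q ^ (b ∸ a) * q ^ a ∎)

n<m^n : ∀ {m} n → 2 ≤ m → n < m ^ n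
n<m^n zero    _   = s≤s z≤n
n<m^n {m} (suc n) 2≤m = ≤-<-trans (n<m^n n 2≤m)
  (subst (m ^ n <_) (*-comm (m ^ n) m) (m<m*n (m ^ n) m {{m^n≢0 m n {{>-nonZero (≤-trans (s≤s z≤n) 2≤m)}}}} 2≤m))

∣prime^*⇒∣ : ∀ {r d x} e → Prime r → 1 ≤ d → ¬ r ∣ d → d ∣ r ^ e * x → d ∣ x
∣prime^*⇒∣ e pr 1≤d r∤d = coprime-divisor (noCommonPrime⇒coprime 1≤d λ s ps s∣d s∣r^e →
  r∤d (subst (_∣ _) (prime∣prime⇒≡ ps pr (prime∣^⇒∣ _ e ps s∣r^e)) s∣d))

^*-exact : ∀ {s a R} e → Prime s → a ≡ s ^ e * R → ¬ s ∣ R → s ^ e ∥ a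
^*-exact {s} {R = R} e ps refl s∤R =
  m∣m*n R , λ s^e*s∣ → s∤R (*-cancelˡ-∣ (s ^ e) {{m^n≢0 s e {{prime⇒nonZero ps}}}}
    (subst (_∣ s ^ e * R) (*-comm s (s ^ e)) s^e*s∣))

1≤*⇒1≤ˡ : ∀ a {b} → 1 ≤ a * b → 1 ≤ a
1≤*⇒1≤ˡ zero    ()
1≤*⇒1≤ˡ (suc a) _ = s≤s z≤n

1≤*⇒1≤ʳ : ∀ a {b} → 1 ≤ a * b → 1 ≤ b
1≤*⇒1≤ʳ a {b} = 1≤*⇒1≤ˡ b ∘ subst (1 ≤_) (*-comm a b)

cofactor-bounds : ∀ {a q r} → a ≡ q * r → 1 ≤ a → 2 ≤ r → 1 ≤ q × q < a
cofactor-bounds {q = zero}  refl ()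
cofactor-bounds {q = suc q} {r} refl _ 2≤r = s≤s z≤n , m<m*n (suc q) r 2≤r

extractPrimePower : ∀ {r} → Prime r → ∀ a → 1 ≤ a →
  ∃₂ λ j a′ → a ≡ r ^ j * a′ × 1 ≤ a′ × ¬ r ∣ a′
extractPrimePower {r} pr = <-rec (λ a → 1 ≤ a → Split a) go
  where
  Split : ℕ → Set
  Split a = ∃₂ λ j a′ → a ≡ r ^ j * a′ × 1 ≤ a′ × ¬ r ∣ a′
  go : ∀ a → (∀ {b} → b < a → 1 ≤ b → Split b) → 1 ≤ a → Split a
  go a rec 1≤a with r ∣? a
  ... | no r∤a = 0 , a , sym (+-identityʳ a) , 1≤a , r∤a
  ... | yes (divides q a≡q*r) =
    let 1≤q , q<a = cofactor-bounds {q = q} a≡q*r 1≤a (prime⇒2≤ pr)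
        j , a′ , q≡ , 1≤a′ , r∤a′ = rec q<a 1≤q
    in  suc j , a′ , (begin
          a               ≡⟨ a≡q*r ⟩
          q * r           ≡⟨ cong (_* r) q≡ ⟩
          r ^ j * a′ * r  ≡⟨ *-comm (r ^ j * a′) r ⟩
          r * (r ^ j * a′) ≡⟨ *-assoc r (r ^ j) a′ ⟨
          r ^ suc j * a′  ∎) , 1≤a′ , r∤a′

primePower-ind : (P : ℕ → Set) → P 1 →
  (∀ {r} j a → Prime r → 1 ≤ a → ¬ r ∣ a → P a → P (r ^ suc j * a)) →
  ∀ a → 1 ≤ a → P a
primePower-ind P base step = <-rec (λ a → 1 ≤ a → P a) go
  where
  go : ∀ a → (∀ {b} → b < a → 1 ≤ b → P b) → 1 ≤ a → P a
  go (suc zero) _ _ = base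
  go a@(suc (suc _)) rec 1≤a
    with r , pr , r∣a ← ∃primeDivisor {a} (s≤s (s≤s z≤n))
    with extractPrimePower pr a 1≤a
  ... | zero , a′ , a≡ , _ , r∤a′ = ⊥-elim (r∤a′ (subst (r ∣_) (trans a≡ (*-identityˡ a′)) r∣a))
  ... | suc j , a′ , a≡ , 1≤a′ , r∤a′ =
    subst P (sym a≡) (step j a′ pr 1≤a′ r∤a′ (rec a′<a 1≤a′))
    where
    a′<a : a′ < a
    a′<a = proj₂ (cofactor-bounds (trans a≡ (*-comm (r ^ suc j) a′)) 1≤a
             (≤-trans (prime⇒2≤ pr) (m≤m*n r (r ^ j) {{m^n≢0 r j {{prime⇒nonZero pr}}}})))

-- The valuation val and Ω

module _ {q} (pq : Prime q) where

  private
    instance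
      q≢0 : NonZero q
      q≢0 = prime⇒nonZero pq

  val-^* : ∀ v {y} → 1 ≤ y → ¬ q ∣ y → val q (q ^ v * y) ≡ v
  val-^* v {y} 1≤y q∤y = begin
    val q x                                                   ≡⟨ val≡∑ q x ⟩
    ∑[ i < x ] restrict (λ e → q ^ e ∣? x) (λ _ → 1) (suc i)  ≡⟨ ∑<-cong x (λ i _ → restrict-cong (λ e → q ^ e ∣? x) (λ _ → 1) (_≤? v) (suc i) divides⇒≤ ≤⇒divides) ⟩
    ∑[ i < x ] restrict (_≤? v) (λ _ → 1) (suc i)             ≡⟨ ∑<-truncate _ v≤x beyond ⟩
    ∑[ i < v ] restrict (_≤? v) (λ _ → 1) (suc i)             ≡⟨ ∑<-cong v (λ i i<v → restrict-yes (_≤? v) _ i<v) ⟩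
    ∑[ i < v ] 1                                              ≡⟨ ∑<-1 v ⟩
    v                                                         ∎
    where
    x : ℕ
    x = q ^ v * y
    divides⇒≤ : ∀ {e} → q ^ e ∣ x → e ≤ v
    divides⇒≤ q^e∣x = ≮⇒≥ λ v<e → q∤y (*-cancelˡ-∣ (q ^ v) {{m^n≢0 q v}}
      (subst (_∣ x) (*-comm q (q ^ v)) (∣-trans (^-monoʳ-∣ q v<e) q^e∣x)))
    ≤⇒divides : ∀ {e} → e ≤ v → q ^ e ∣ x
    ≤⇒divides e≤v = ∣-trans (^-monoʳ-∣ q e≤v) (m∣m*n y)
    v≤x : v ≤ x
    v≤x = ≤-trans (<⇒≤ (n<m^n v (prime⇒2≤ pq))) (m≤m*n (q ^ v) y {{>-nonZero 1≤y}})
    beyond : ∀ i → v ≤ i → restrict (_≤? v) (λ _ → 1) (suc i) ≡ 0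
    beyond i v≤i = restrict-no (_≤? v) _ (<⇒≱ (s≤s v≤i))

  val-< : ∀ {x} → 1 ≤ x → x < q → val q x ≡ 0
  val-< {x} 1≤x x<q = trans (cong (val q) (sym (*-identityˡ x)))
    (val-^* 0 1≤x λ q∣x → <⇒≱ x<q (∣⇒≤ {{>-nonZero 1≤x}} q∣x))

  val-*-self : ∀ {m} → 1 ≤ m → val q (q * m) ≡ suc (val q m)
  val-*-self {m} 1≤m with v , m′ , refl , 1≤m′ , q∤m′ ← extractPrimePower pq m 1≤m = begin
    val q (q * (q ^ v * m′))  ≡⟨ cong (val q) (*-assoc q (q ^ v) m′) ⟨
    val q (q ^ suc v * m′)    ≡⟨ val-^* (suc v) 1≤m′ q∤m′ ⟩
    suc v                     ≡⟨ cong suc (val-^* v 1≤m′ q∤m′) ⟨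
    suc (val q (q ^ v * m′))  ∎

  val-*-other : ∀ {p m} → Prime p → q ≢ p → 1 ≤ m → val q (p * m) ≡ val q m
  val-*-other {p} {m} pp q≢p 1≤m with v , m′ , refl , 1≤m′ , q∤m′ ← extractPrimePower pq m 1≤m = begin
    val q (p * (q ^ v * m′))  ≡⟨ cong (val q) (*-CS.x∙yz≈y∙xz p (q ^ v) m′) ⟩
    val q (q ^ v * (p * m′))  ≡⟨ val-^* v 1≤pm′ (prime∤* pq q∤p q∤m′) ⟩
    v                         ≡⟨ val-^* v 1≤m′ q∤m′ ⟨
    val q (q ^ v * m′)        ∎
    where
    q∤p : ¬ q ∣ p
    q∤p = q≢p ∘ prime∣prime⇒≡ pq pp
    1≤pm′ : 1 ≤ p * m′
    1≤pm′ = *-mono-≤ (≤-trans (s≤s z≤n) (prime⇒2≤ pp)) 1≤m′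

ΩUpTo : ℕ → ℕ → ℕ
ΩUpTo N m = ∑[ i < N ] restrict prime? (λ q → val q m) (suc i)

ΩUpTo≡Ω : ∀ {m N} → 1 ≤ m → m ≤ N → ΩUpTo N m ≡ Ω m
ΩUpTo≡Ω {m} 1≤m m≤N = trans (∑<-truncate _ m≤N beyond) (sym (Ω≡∑ m))
  where
  beyond : ∀ i → m ≤ i → restrict prime? (λ q → val q m) (suc i) ≡ 0
  beyond i m≤i with prime? (suc i)
  ... | yes pq = val-< pq 1≤m (s≤s m≤i)
  ... | no  _  = refl

module _ {p m} (pp : Prime p) (1≤m : 1 ≤ m) where

  private
    Ωterm-*-other : ∀ d → d ≢ p →
      restrict prime? (λ q → val q (p * m)) d ≡ restrict prime? (λ q → val q m) d
    Ωterm-*-other d d≢p with prime? d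
    ... | yes pd = val-*-other pd pp d≢p 1≤m
    ... | no  _  = refl

    Ωterm-*-self : restrict prime? (λ q → val q (p * m)) p ≡ suc (restrict prime? (λ q → val q m) p)
    Ωterm-*-self with prime? p
    ... | yes _  = val-*-self pp 1≤m
    ... | no ¬pp = ⊥-elim (¬pp pp)

  ΩUpTo-*-< : ∀ N → N < p → ΩUpTo N (p * m) ≡ ΩUpTo N m
  ΩUpTo-*-< N N<p = ∑<-cong N λ i i<N → Ωterm-*-other (suc i) (<⇒≢ (≤-<-trans i<N N<p))

  ΩUpTo-*-≥ : ∀ N → p ≤ N → ΩUpTo N (p * m) ≡ suc (ΩUpTo N m)
  ΩUpTo-*-≥ zero p≤0 = ⊥-elim (<⇒≱ (prime⇒2≤ pp) (≤-trans p≤0 z≤n))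
  ΩUpTo-*-≥ (suc N) p≤1+N with m≤n⇒m<n∨m≡n p≤1+N
  ... | inj₁ p<1+N = cong₂ _+_ (ΩUpTo-*-≥ N (≤-pred p<1+N)) (Ωterm-*-other (suc N) (>⇒≢ p<1+N))
  ... | inj₂ refl  = trans (cong₂ _+_ (ΩUpTo-*-< N ≤-refl) Ωterm-*-self) (+-suc (ΩUpTo N m) _)

  Ω-*prime : Ω (p * m) ≡ suc (Ω m)
  Ω-*prime = begin
    Ω (p * m)                ≡⟨ ΩUpTo≡Ω 1≤pm ≤-refl ⟨
    ΩUpTo (p * m) (p * m)    ≡⟨ ΩUpTo-*-≥ (p * m) (m≤m*n p m {{>-nonZero 1≤m}}) ⟩
    suc (ΩUpTo (p * m) m)    ≡⟨ cong suc (ΩUpTo≡Ω 1≤m (m≤n*m m p {{prime⇒nonZero pp}})) ⟩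
    suc (Ω m)                ∎
    where
    1≤pm : 1 ≤ p * m
    1≤pm = *-mono-≤ (≤-trans (s≤s z≤n) (prime⇒2≤ pp)) 1≤m

Ω-product : ∀ {ps} → All Prime ps → Ω (product ps) ≡ length ps
Ω-product []                     = refl
Ω-product {p ∷ ps} (pp ∷ primes) =
  trans (Ω-*prime pp (productOfPrimes≥1 primes)) (cong suc (Ω-product primes))

-- The divisor sum σ

σ-∑-beyond : ∀ {m N} → 1 ≤ m → m ≤ N → ∑[ i < N ] divisorTerm m (suc i) ≡ σ m
σ-∑-beyond {m} 1≤m m≤N = trans (∑<-truncate _ m≤N beyond) (sym (σ≡∑ m))
  where
  beyond : ∀ i → m ≤ i → divisorTerm m (suc i) ≡ 0
  beyond i m≤i = restrict-no (_∣? m) id λ 1+i∣m → <⇒≱ (s≤s m≤i) (∣⇒≤ {{>-nonZero 1≤m}} 1+i∣m)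

divisorTerm-*ˡ : ∀ r {y} e .{{_ : NonZero r}} → divisorTerm (r * y) (r * e) ≡ r * divisorTerm y e
divisorTerm-*ˡ r {y} e with e ∣? y
... | yes e∣y = restrict-yes (_∣? r * y) id (*-monoʳ-∣ r e∣y)
... | no  e∤y = trans (restrict-no (_∣? r * y) id (e∤y ∘ *-cancelˡ-∣ r)) (sym (*-zeroʳ r))

geometricSum : ℕ → ℕ → ℕ
geometricSum r zero    = 1
geometricSum r (suc j) = r * geometricSum r j + 1

module _ {r} (pr : Prime r) {x} (1≤x : 1 ≤ x) (r∤x : ¬ r ∣ x) where

  private
    instance
      r≢0 : NonZero r
      r≢0 = prime⇒nonZero pr

  -- Divisors of r (r^j x) divisible by r are r times divisors of r^j x; the others divide x.
  σ-*prime : ∀ j → σ (r * (r ^ j * x)) ≡ r * σ (r ^ j * x) + σ x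
  σ-*prime j = begin
    σ m                                                       ≡⟨ σ≡∑ m ⟩
    ∑[ i < m ] T (suc i)                                      ≡⟨ ∑<-cong m (λ i _ → restrict-split (r ∣?_) T (suc i)) ⟩
    ∑[ i < m ] (A (suc i) + B (suc i))                        ≡⟨ ∑<-+ m (A ∘ suc) (B ∘ suc) ⟩
    ∑[ i < r * y ] A (suc i) + ∑[ i < m ] B (suc i)           ≡⟨ cong₂ _+_ (∑<-stride r y A (λ _ → restrict-no (r ∣?_) T))
                                                                           (∑<-cong m λ i _ → B≡divisorTerm (suc i)) ⟩
    ∑[ i < y ] A (r * suc i) + ∑[ i < m ] divisorTerm x (suc i)
                                                              ≡⟨ cong₂ _+_ (∑<-cong y λ i _ → A-multiple (suc i)) (σ-∑-beyond 1≤x x≤m) ⟩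
    ∑[ i < y ] (r * divisorTerm y (suc i)) + σ x              ≡⟨ cong (_+ σ x) (∑<-*ˡ y r (divisorTerm y ∘ suc)) ⟩
    r * ∑[ i < y ] divisorTerm y (suc i) + σ x                ≡⟨ cong (λ s → r * s + σ x) (σ≡∑ y) ⟨
    r * σ y + σ x                                             ∎
    where
    y m : ℕ
    y = r ^ j * x
    m = r * y
    T A B : ℕ → ℕ
    T = divisorTerm m
    A = restrict (r ∣?_) T
    B = restrict (¬? ∘ (r ∣?_)) T
    x≤m : x ≤ m
    x≤m = ≤-trans (m≤n*m x (r ^ j) {{m^n≢0 r j}}) (m≤n*m y r)
    A-multiple : ∀ e → A (r * e) ≡ r * divisorTerm y e
    A-multiple e = trans (restrict-yes (r ∣?_) T (m∣m*n e)) (divisorTerm-*ˡ r e)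
    d∣m⇒d∣x : ∀ {d} → ¬ r ∣ d → d ∣ m → d ∣ x
    d∣m⇒d∣x {d} r∤d d∣m = ∣prime^*⇒∣ (suc j) pr (n≢0⇒n>0 λ { refl → r∤d (r ∣0) }) r∤d
      (subst (d ∣_) (sym (*-assoc r (r ^ j) x)) d∣m)
    B≡divisorTerm : ∀ d → B d ≡ divisorTerm x d
    B≡divisorTerm d = case r ∣? d of λ where
      (yes r∣d) → trans (restrict-no (¬? ∘ (r ∣?_)) T (λ r∤d → r∤d r∣d))
                            (sym (restrict-no (_∣? x) id (r∤x ∘ ∣-trans r∣d)))
      (no  r∤d) → trans (restrict-yes (¬? ∘ (r ∣?_)) T r∤d)
                            (restrict-cong (_∣? m) id (_∣? x) d (d∣m⇒d∣x r∤d) (∣n⇒∣m*n r ∘ ∣n⇒∣m*n (r ^ j)))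

  σ-^* : ∀ j → σ (r ^ j * x) ≡ geometricSum r j * σ x
  σ-^* zero    = trans (cong σ (*-identityˡ x)) (sym (*-identityˡ (σ x)))
  σ-^* (suc j) = begin
    σ (r * r ^ j * x)                         ≡⟨ cong σ (*-assoc r (r ^ j) x) ⟩
    σ (r * (r ^ j * x))                       ≡⟨ σ-*prime j ⟩
    r * σ (r ^ j * x) + σ x                   ≡⟨ cong (λ s → r * s + σ x) (σ-^* j) ⟩
    r * (geometricSum r j * σ x) + σ x        ≡⟨ cong₂ _+_ (*-assoc r (geometricSum r j) (σ x)) (*-identityˡ (σ x)) ⟨
    r * geometricSum r j * σ x + 1 * σ x      ≡⟨ *-distribʳ-+ (σ x) (r * geometricSum r j) 1 ⟨
    geometricSum r (suc j) * σ x              ∎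

σ-multiplicative : ∀ {a b} → 1 ≤ a → 1 ≤ b → Coprime a b → σ (a * b) ≡ σ a * σ b
σ-multiplicative {a} 1≤a = primePower-ind P base step a 1≤a
  where
  P : ℕ → Set
  P a = ∀ {b} → 1 ≤ b → Coprime a b → σ (a * b) ≡ σ a * σ b
  base : P 1
  base {b} _ _ = trans (cong σ (*-identityˡ b)) (sym (*-identityˡ (σ b)))
  step : ∀ {r} j a → Prime r → 1 ≤ a → ¬ r ∣ a → P a → P (r ^ suc j * a)
  step {r} j a pr 1≤a r∤a ih {b} 1≤b coprime = begin
    σ (R * a * b)                       ≡⟨ cong σ (*-assoc R a b) ⟩
    σ (R * (a * b))                     ≡⟨ σ-^* pr (*-mono-≤ 1≤a 1≤b) (prime∤* pr r∤a r∤b) (suc j) ⟩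
    geometricSum r (suc j) * σ (a * b)  ≡⟨ cong (geometricSum r (suc j) *_) (ih 1≤b coprime′) ⟩
    geometricSum r (suc j) * (σ a * σ b) ≡⟨ *-assoc (geometricSum r (suc j)) (σ a) (σ b) ⟨
    geometricSum r (suc j) * σ a * σ b  ≡⟨ cong (_* σ b) (σ-^* pr 1≤a r∤a (suc j)) ⟨
    σ (R * a) * σ b                     ∎
    where
    R : ℕ
    R = r ^ suc j
    r∤b : ¬ r ∣ b
    r∤b r∣b = ¬prime∣1 pr (subst (r ∣_) (coprime (∣-trans (m∣m*n (r ^ j)) (m∣m*n a) , r∣b)) ∣-refl)
    coprime′ : Coprime a b
    coprime′ (c∣a , c∣b) = coprime (∣-trans c∣a (n∣m*n R) , c∣b)

-- Residues modulo 4

module _ {n} .{{_ : NonZero n}} where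

  %-+-cong : ∀ {a a′ b b′} → a % n ≡ a′ % n → b % n ≡ b′ % n → (a + b) % n ≡ (a′ + b′) % n
  %-+-cong {a} {a′} {b} {b′} a≡a′ b≡b′ = begin
    (a + b) % n               ≡⟨ %-distribˡ-+ a b n ⟩
    (a % n + b % n) % n       ≡⟨ cong₂ (λ u v → (u + v) % n) a≡a′ b≡b′ ⟩
    (a′ % n + b′ % n) % n     ≡⟨ %-distribˡ-+ a′ b′ n ⟨
    (a′ + b′) % n             ∎

  %-*-cong : ∀ {a a′ b b′} → a % n ≡ a′ % n → b % n ≡ b′ % n → a * b % n ≡ a′ * b′ % n
  %-*-cong {a} {a′} {b} {b′} a≡a′ b≡b′ = begin
    a * b % n                 ≡⟨ %-distribˡ-* a b n ⟩
    (a % n) * (b % n) % n     ≡⟨ cong₂ (λ u v → u * v % n) a≡a′ b≡b′ ⟩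
    (a′ % n) * (b′ % n) % n   ≡⟨ %-distribˡ-* a′ b′ n ⟨
    a′ * b′ % n               ∎

  %-^-cong : ∀ {a b} e → a % n ≡ b % n → a ^ e % n ≡ b ^ e % n
  %-^-cong zero    _   = refl
  %-^-cong (suc e) a≡b = %-*-cong a≡b (%-^-cong e a≡b)

  %-*-≡1 : ∀ a {b} → b % n ≡ 1 % n → a * b % n ≡ a % n
  %-*-≡1 a {b} b≡1 = trans (%-*-cong {a} {a} {b} {1} refl b≡1) (cong (_% n) (*-identityʳ a))

  product-%-const : ∀ {c xs} → All (λ x → x % n ≡ c % n) xs → product xs % n ≡ c ^ length xs % n
  product-%-const []         = refl
  product-%-const (x≡c ∷ xs≡c) = %-*-cong x≡c (product-%-const xs≡c)

3^%4 : ∀ e → 3 ^ e % 4 ≡ 1 + 2 * (e % 2)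
3^%4 zero          = refl
3^%4 (suc zero)    = refl
3^%4 (suc (suc e)) = begin
  3 * (3 * 3 ^ e) % 4        ≡⟨ cong (_% 4) (*-assoc 3 3 (3 ^ e)) ⟨
  9 * 3 ^ e % 4              ≡⟨ %-*-cong {4} {9} {1} {3 ^ e} {3 ^ e} refl refl ⟩
  1 * 3 ^ e % 4              ≡⟨ cong (_% 4) (*-identityˡ (3 ^ e)) ⟩
  3 ^ e % 4                  ≡⟨ 3^%4 e ⟩
  1 + 2 * (e % 2)            ≡⟨ cong (λ k → 1 + 2 * k) ([m+n]%n≡m%n e 2) ⟨
  1 + 2 * ((e + 2) % 2)      ≡⟨ cong (λ k → 1 + 2 * (k % 2)) (+-comm e 2) ⟩
  1 + 2 * (suc (suc e) % 2)  ∎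

3^[2*t]%4≡1 : ∀ t → 3 ^ (2 * t) % 4 ≡ 1
3^[2*t]%4≡1 t = trans (3^%4 (2 * t)) (cong (λ k → 1 + 2 * k) (trans (cong (_% 2) (*-comm 2 t)) (m*n%n≡0 t 2)))

3^odd%4≡3 : ∀ e → Odd e → 3 ^ e % 4 ≡ 3
3^odd%4≡3 e odd = trans (3^%4 e) (cong (λ k → 1 + 2 * k) odd)

3^%4≡1⇒even : ∀ e → 3 ^ e % 4 ≡ 1 → e % 2 ≡ 0
3^%4≡1⇒even e ≡1 = m+n≡0⇒m≡0 (e % 2) (suc-injective (trans (sym (3^%4 e)) ≡1))

AllPrimeDivisors≡3%4 : ℕ → Set
AllPrimeDivisors≡3%4 m = ∀ p → Prime p → p ∣ m → p % 4 ≡ 3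

AllPrimeDivisors≡3%4-∣ : ∀ {a b} → a ∣ b → AllPrimeDivisors≡3%4 b → AllPrimeDivisors≡3%4 a
AllPrimeDivisors≡3%4-∣ a∣b h p pp p∣a = h p pp (∣-trans p∣a a∣b)

Ω-%4 : ∀ {m} → 1 ≤ m → AllPrimeDivisors≡3%4 m → m % 4 ≡ 3 ^ Ω m % 4
Ω-%4 {m@(suc _)} _ h = begin
  m % 4                  ≡⟨ cong (_% 4) m≡∏ ⟩
  product ps % 4         ≡⟨ product-%-const (All.tabulate λ p∈ps →
                              h _ (All.lookup primes p∈ps) (subst (_ ∣_) (sym m≡∏) (∈⇒∣product p∈ps))) ⟩
  3 ^ length ps % 4      ≡⟨ cong (λ e → 3 ^ e % 4) (trans (cong Ω m≡∏) (Ω-product primes)) ⟨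
  3 ^ Ω m % 4            ∎
  where
  open PrimeFactorisation (factorise m) renaming (factors to ps; isFactorisation to m≡∏; factorsPrime to primes)

Ω-even : ∀ {m} → 1 ≤ m → AllPrimeDivisors≡3%4 m → m % 4 ≡ 1 → Ω m % 2 ≡ 0
Ω-even {m} 1≤m h m≡1 = 3^%4≡1⇒even (Ω m) (trans (sym (Ω-%4 1≤m h)) m≡1)

square%4 : ∀ {M} → 1 ≤ M → AllPrimeDivisors≡3%4 M → M * M % 4 ≡ 1
square%4 {M} 1≤M h = begin
  M * M % 4                    ≡⟨ %-*-cong {4} {M} {3 ^ Ω M} {M} {3 ^ Ω M} (Ω-%4 1≤M h) (Ω-%4 1≤M h) ⟩
  3 ^ Ω M * 3 ^ Ω M % 4        ≡⟨ cong (_% 4) (^-distribˡ-+-* 3 (Ω M) (Ω M)) ⟨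
  3 ^ (Ω M + Ω M) % 4          ≡⟨ cong (λ e → 3 ^ (Ω M + e) % 4) (+-identityʳ (Ω M)) ⟨
  3 ^ (2 * Ω M) % 4            ≡⟨ 3^[2*t]%4≡1 (Ω M) ⟩
  1                            ∎

geometricSum-even%4 : ∀ r → r % 4 ≡ 3 → ∀ j → geometricSum r (j + j) % 4 ≡ 1
geometricSum-even%4 r r≡3 zero    = refl
geometricSum-even%4 r r≡3 (suc j) = begin
  geometricSum r (suc j + suc j) % 4                 ≡⟨ cong (λ e → geometricSum r e % 4) (+-suc (suc j) j) ⟩
  (r * (r * geometricSum r (j + j) + 1) + 1) % 4    ≡⟨ %-+-cong {4} {r * X} {3 * 0} {1} {1} (%-*-cong {4} {r} {3} {X} {0} r≡3 inner) refl ⟩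
  (3 * 0 + 1) % 4                                    ≡⟨⟩
  1                                                  ∎
  where
  X : ℕ
  X = r * geometricSum r (j + j) + 1
  inner : X % 4 ≡ 0
  inner = %-+-cong {4} {r * geometricSum r (j + j)} {3 * 1} {1} {1}
    (%-*-cong {4} {r} {3} {geometricSum r (j + j)} {1} r≡3 (geometricSum-even%4 r r≡3 j)) refl

σ-square%4 : ∀ {M} → 1 ≤ M → AllPrimeDivisors≡3%4 M → σ (M * M) % 4 ≡ 1
σ-square%4 {M} = primePower-ind (λ M → AllPrimeDivisors≡3%4 M → σ (M * M) % 4 ≡ 1) (λ _ → refl) step M
  where
  step : ∀ {r} j a → Prime r → 1 ≤ a → ¬ r ∣ a →
    (AllPrimeDivisors≡3%4 a → σ (a * a) % 4 ≡ 1) →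
    AllPrimeDivisors≡3%4 (r ^ suc j * a) → σ (r ^ suc j * a * (r ^ suc j * a)) % 4 ≡ 1
  step {r} j a pr 1≤a r∤a ih h = begin
    σ (R * a * (R * a)) % 4                               ≡⟨ cong (λ x → σ x % 4) (*-CS.interchange R a R a) ⟩
    σ (R * R * (a * a)) % 4                               ≡⟨ cong (λ x → σ (x * (a * a)) % 4) (^-distribˡ-+-* r (suc j) (suc j)) ⟨
    σ (r ^ (suc j + suc j) * (a * a)) % 4                 ≡⟨ cong (_% 4) (σ-^* pr (*-mono-≤ 1≤a 1≤a) (prime∤* pr r∤a r∤a) (suc j + suc j)) ⟩
    G * σ (a * a) % 4                                     ≡⟨ %-*-cong {4} {G} {1} {σ (a * a)} {1} G≡1 σ[a*a]≡1 ⟩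
    1                                                     ∎
    where
    R G : ℕ
    R = r ^ suc j
    G = geometricSum r (suc j + suc j)
    r≡3 : r % 4 ≡ 3
    r≡3 = h r pr (∣-trans (m∣m*n (r ^ j)) (m∣m*n a))
    G≡1 : G % 4 ≡ 1
    G≡1 = geometricSum-even%4 r r≡3 (suc j)
    σ[a*a]≡1 : σ (a * a) % 4 ≡ 1
    σ[a*a]≡1 = ih (AllPrimeDivisors≡3%4-∣ {a} {R * a} (n∣m*n R) h)

%4≡1⇒¬2∣ : ∀ {B} → B % 4 ≡ 1 → ¬ 2 ∣ B
%4≡1⇒¬2∣ {B} B≡1 2∣B = 1+n≢0 (begin
  1 % 2          ≡⟨ cong (_% 2) B≡1 ⟨
  B % 4 % 2      ≡⟨ m∣n⇒o%n%m≡o%m 2 4 B (divides 2 refl) ⟩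
  B % 2          ≡⟨ n∣m⇒m%n≡0 B 2 2∣B ⟩
  0              ∎)

/2^-oddCofactor : ∀ {A B} k {n} → A * B ≡ 2 ^ k * n → ¬ 2 ∣ B → A /2^ k * 2 ^ k ≡ A × A /2^ k * B ≡ n
/2^-oddCofactor {A} {B} k {n} A*B≡ 2∤B = quotient*2^k≡A , *-cancelˡ-≡ (A /2^ k * B) n (2 ^ k) (begin
    2 ^ k * (A /2^ k * B)      ≡⟨ *-assoc (2 ^ k) (A /2^ k) B ⟨
    2 ^ k * (A /2^ k) * B      ≡⟨ cong (_* B) (trans (*-comm (2 ^ k) (A /2^ k)) quotient*2^k≡A) ⟩
    A * B                      ≡⟨ A*B≡ ⟩
    2 ^ k * n                  ∎)
  where
  instance
    2^k≢0 : NonZero (2 ^ k)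
    2^k≢0 = >-nonZero (m^n>0 2 k)
  coprime : Coprime (2 ^ k) B
  coprime = noCommonPrime⇒coprime (m^n>0 2 k) λ s ps s∣2^k s∣B →
    2∤B (subst (_∣ B) (prime∣prime⇒≡ ps prime[2] (prime∣^⇒∣ 2 k ps s∣2^k)) s∣B)
  quotient*2^k≡A : A /2^ k * 2 ^ k ≡ A
  quotient*2^k≡A = m/n*n≡m (coprime-divisor coprime (subst (2 ^ k ∣_) (trans (sym A*B≡) (*-comm A B)) (m∣m*n n)))

-- Euler parts

eulerPart-coprime : ∀ {n Π M} → IsEulerPart n Π → n ≡ Π * (M * M) → Coprime Π (M * M)
eulerPart-coprime {Π = Π} {M} (1≤Π , exact) refl = noCommonPrime⇒coprime 1≤Π noCommon
  where
  noCommon : ∀ s → Prime s → s ∣ Π → s ∣ M * M → ⊥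
  noCommon s ps s∣Π s∣MM with extractPrimePower ps Π 1≤Π
  ... | zero , Π′ , Π≡ , _ , s∤Π′ = s∤Π′ (subst (s ∣_) (trans Π≡ (*-identityˡ Π′)) s∣Π)
  ... | suc j , Π′ , Π≡ , _ , s∤Π′ = proj₂ (proj₁ (proj₁ (exact s (suc j) ps (s≤s z≤n)) s^j+1∥Π))
    (subst (_∣ Π * (M * M)) (*-comm (s ^ suc j) s) (*-pres-∣ (proj₁ s^j+1∥Π) s∣MM))
    where
    s^j+1∥Π : s ^ suc j ∥ Π
    s^j+1∥Π = ^*-exact (suc j) ps Π≡ s∤Π′

prime∣∏ppow⇒base : ∀ {r} L → Prime r → All (Prime ∘ proj₁) L → r ∣ product (map ppow L) →
  Any ((r ≡_) ∘ proj₁) L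
prime∣∏ppow⇒base []            pr []        r∣1 = ⊥-elim (¬prime∣1 pr r∣1)
prime∣∏ppow⇒base ((p , e) ∷ L) pr (pp ∷ ps) r∣  with euclidsLemma (p ^ e) (product (map ppow L)) pr r∣
... | inj₁ r∣p^e  = here (prime∣prime⇒≡ pr pp (prime∣^⇒∣ p e pr r∣p^e))
... | inj₂ r∣rest = there (prime∣∏ppow⇒base L pr ps r∣rest)

∈⇒∏ppow-exact : ∀ {L p e} → All (Prime ∘ proj₁) L → Unique (map proj₁ L) → (p , e) ∈ L →
  p ^ e ∥ product (map ppow L)
∈⇒∏ppow-exact {L} {p} {e} primes unique p,e∈L =
  let R , ∏≡ , p∤R = split L primes unique p,e∈L in ^*-exact e (All.lookup primes p,e∈L) ∏≡ p∤R
  where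
  split : ∀ L → All (Prime ∘ proj₁) L → Unique (map proj₁ L) → (p , e) ∈ L →
    ∃ λ R → product (map ppow L) ≡ p ^ e * R × ¬ p ∣ R
  split (_ ∷ L) (pp ∷ ps) (p∉L ∷ _) (here refl) =
    product (map ppow L) , refl , All¬⇒¬Any (map⁻ p∉L) ∘ prime∣∏ppow⇒base L pp ps
  split ((q , f) ∷ L) (pq ∷ ps) (q∉L ∷ unique) (there p,e∈L) =
    let R , ∏≡ , p∤R = split L ps unique p,e∈L
        pp = All.lookup ps p,e∈L
        q≢p = All.lookup (map⁻ q∉L) p,e∈L
    in  q ^ f * R , trans (cong (q ^ f *_) ∏≡) (*-CS.x∙yz≈y∙xz (q ^ f) (p ^ e) R) ,
        prime∤* pp (λ p∣q^f → q≢p (sym (prime∣prime⇒≡ pp pq (prime∣^⇒∣ q f pp p∣q^f)))) p∤R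

PrimePowersMod4 : ℕ → List (ℕ × ℕ) → Set
PrimePowersMod4 c = All (λ pe → Prime (proj₁ pe) × proj₁ pe % 4 ≡ c × 1 ≤ proj₂ pe)

∏ppow-++ : ∀ Ps Qs → product (map ppow (Ps ++ Qs)) ≡ product (map ppow Ps) * product (map ppow Qs)
∏ppow-++ Ps Qs = trans (cong product (map-++ ppow Ps Qs)) (product-++ (map ppow Ps) (map ppow Qs))

∏ppow≡1%4 : ∀ {L} → All (λ pe → proj₁ pe % 4 ≡ 1) L → product (map ppow L) % 4 ≡ 1
∏ppow≡1%4 {L} bases≡1 = begin
  product (map ppow L) % 4      ≡⟨ product-%-const {c = 1} (map⁺ (All.map (λ {pe} → power≡1 {pe}) bases≡1)) ⟩
  1 ^ length (map ppow L) % 4   ≡⟨ cong (_% 4) (^-zeroˡ (length (map ppow L))) ⟩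
  1                             ∎
  where
  power≡1 : ∀ {pe} → proj₁ pe % 4 ≡ 1 → ppow pe % 4 ≡ 1 % 4
  power≡1 {p , e} p≡1 = trans (%-^-cong {4} {p} {1} e p≡1) (cong (_% 4) (^-zeroˡ e))

∏ppow≡3^length%4 : ∀ {L} → All (λ qf → proj₁ qf % 4 ≡ 3 × Odd (proj₂ qf)) L →
  product (map ppow L) % 4 ≡ 3 ^ length L % 4
∏ppow≡3^length%4 {L} h = begin
  product (map ppow L) % 4      ≡⟨ product-%-const {c = 3} (map⁺ (All.map (λ {qf} → power≡3 {qf}) h)) ⟩
  3 ^ length (map ppow L) % 4   ≡⟨ cong (λ l → 3 ^ l % 4) (length-map ppow L) ⟩
  3 ^ length L % 4              ∎
  where
  power≡3 : ∀ {qf} → proj₁ qf % 4 ≡ 3 × Odd (proj₂ qf) → ppow qf % 4 ≡ 3 % 4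
  power≡3 {q , f} (q≡3 , odd) = trans (%-^-cong {4} {q} {3} f q≡3) (3^odd%4≡3 f odd)

eulerPart≡1%4 : ∀ {n Π t} Ps Qs → IsEulerPart n Π → PrimePowersMod4 1 Ps → PrimePowersMod4 3 Qs →
  length Qs ≡ 2 * t → Unique (map proj₁ (Ps ++ Qs)) →
  Π ≡ product (map ppow Ps) * product (map ppow Qs) → Π % 4 ≡ 1
eulerPart≡1%4 {Π = Π} {t} Ps Qs (_ , exact) Ps-ok Qs-ok |Qs|≡2t unique Π≡ = begin
  Π % 4                                                ≡⟨ cong (_% 4) Π≡ ⟩
  product (map ppow Ps) * product (map ppow Qs) % 4    ≡⟨ %-*-cong {4} {product (map ppow Ps)} {1} {product (map ppow Qs)} {3 ^ (2 * t)} ∏Ps≡1 ∏Qs≡1 ⟩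
  1 * 3 ^ (2 * t) % 4                                  ≡⟨ cong (_% 4) (*-identityˡ (3 ^ (2 * t))) ⟩
  3 ^ (2 * t) % 4                                      ≡⟨ 3^[2*t]%4≡1 t ⟩
  1                                                    ∎
  where
  ∏Ps≡1 : product (map ppow Ps) % 4 ≡ 1
  ∏Ps≡1 = ∏ppow≡1%4 (All.map (proj₁ ∘ proj₂) Ps-ok)
  exponentOdd : ∀ {q f} → (q , f) ∈ Qs → Prime q → 1 ≤ f → Odd f
  exponentOdd {q} {f} q,f∈Qs pq 1≤f = proj₂ (proj₁ (exact q f pq 1≤f)
    (subst (_^_∥_ q f) (trans (∏ppow-++ Ps Qs) (sym Π≡))
      (∈⇒∏ppow-exact (All-++⁺ (All.map proj₁ Ps-ok) (All.map proj₁ Qs-ok)) unique (∈-++⁺ʳ Ps q,f∈Qs))))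
  ∏Qs≡1 : product (map ppow Qs) % 4 ≡ 3 ^ (2 * t) % 4
  ∏Qs≡1 = trans (∏ppow≡3^length%4 (All.tabulate λ {(q , f)} q,f∈Qs →
            let pq , q≡3 , 1≤f = All.lookup Qs-ok q,f∈Qs in q≡3 , exponentOdd q,f∈Qs pq 1≤f))
          (cong (λ l → 3 ^ l % 4) |Qs|≡2t)

prime∣∏ppow-++⇒base : ∀ {r} Ps Qs → Prime r → All (Prime ∘ proj₁) Ps → All (Prime ∘ proj₁) Qs →
  r ∣ product (map ppow Ps) * product (map ppow Qs) → Any ((r ≡_) ∘ proj₁) Ps ⊎ Any ((r ≡_) ∘ proj₁) Qs
prime∣∏ppow-++⇒base Ps Qs pr Ps-prime Qs-prime r∣ = Any-++⁻ Ps
  (prime∣∏ppow⇒base (Ps ++ Qs) pr (All-++⁺ Ps-prime Qs-prime) (subst (_ ∣_) (sym (∏ppow-++ Ps Qs)) r∣))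

divisor-primeDivisors≡3%4 : ∀ {Π M d m} Ps Qs → PrimePowersMod4 1 Ps → PrimePowersMod4 3 Qs →
  Π ≡ product (map ppow Ps) * product (map ppow Qs) → AllPrimeDivisors≡3%4 M →
  gcd d (product (map proj₁ Ps)) ≡ 1 → m ∣ d → m ∣ Π * (M * M) → AllPrimeDivisors≡3%4 m
divisor-primeDivisors≡3%4 {Π} {M} Ps Qs Ps-ok Qs-ok refl M-primes gcd≡1 m∣d m∣ΠMM r pr r∣m
  with euclidsLemma Π (M * M) pr (∣-trans r∣m m∣ΠMM)
... | inj₂ r∣MM = [ M-primes r pr , M-primes r pr ]′ (euclidsLemma M M pr r∣MM)
... | inj₁ r∣Π with prime∣∏ppow-++⇒base Ps Qs pr (All.map proj₁ Ps-ok) (All.map proj₁ Qs-ok) r∣Π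
...   | inj₁ r∈Ps = ⊥-elim (¬prime∣1 pr (subst (r ∣_) gcd≡1
          (gcd-greatest (∣-trans r∣m m∣d) (∈⇒∣product (Any-map⁺ r∈Ps)))))
...   | inj₂ r∈Qs with (_ , q≡3 , _) , r≡q ← All.lookupAny Qs-ok r∈Qs = subst (λ q → q % 4 ≡ 3) (sym r≡q) q≡3

theorem3p4 : (k n Π M t : ℕ) (Ps Qs : List (ℕ × ℕ)) →
    1 ≤ k → 1 ≤ n → Odd n → σ n ≡ 2 ^ k * n →
    IsEulerPart n Π → n ≡ Π * (M * M) →
    (∀ p → Prime p → p ∣ M → p % 4 ≡ 3) →
    All (λ pe → Prime (proj₁ pe) × proj₁ pe % 4 ≡ 1 × 1 ≤ proj₂ pe) Ps →
    All (λ qf → Prime (proj₁ qf) × proj₁ qf % 4 ≡ 3 × 1 ≤ proj₂ qf) Qs →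
    length Qs ≡ 2 * t →
    Unique (map proj₁ (Ps ++ Qs)) →
    Π ≡ product (map ppow Ps) * product (map ppow Qs) →
    gcd (σ Π) (product (map proj₁ Ps)) ≡ 1 →
    Ω (σ Π /2^ k) % 2 ≡ 0
theorem3p4 k n Π M t Ps Qs _ 1≤n _ σn≡ eulerPart n≡ M-primes Ps-ok Qs-ok |Qs|≡2t unique Π≡ gcd≡1 =
  Ω-even 1≤m m-primes m≡1
  where
  1≤M : 1 ≤ M
  1≤M = 1≤*⇒1≤ˡ M (1≤*⇒1≤ʳ Π (subst (1 ≤_) n≡ 1≤n))
  B : ℕ
  B = σ (M * M)
  B≡1 : B % 4 ≡ 1
  B≡1 = σ-square%4 1≤M M-primes
  σΠ*B≡ : σ Π * B ≡ 2 ^ k * n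
  σΠ*B≡ = trans (sym (σ-multiplicative (proj₁ eulerPart) (*-mono-≤ 1≤M 1≤M) (eulerPart-coprime {M = M} eulerPart n≡)))
                (trans (cong σ (sym n≡)) σn≡)
  m : ℕ
  m = σ Π /2^ k
  m*2^k≡σΠ : m * 2 ^ k ≡ σ Π
  m*2^k≡σΠ = proj₁ (/2^-oddCofactor k σΠ*B≡ (%4≡1⇒¬2∣ B≡1))
  m*B≡n : m * B ≡ n
  m*B≡n = proj₂ (/2^-oddCofactor k σΠ*B≡ (%4≡1⇒¬2∣ B≡1))
  1≤m : 1 ≤ m
  1≤m = 1≤*⇒1≤ˡ m (subst (1 ≤_) (sym m*B≡n) 1≤n)
  n≡1 : n % 4 ≡ 1
  n≡1 = trans (cong (_% 4) n≡) (%-*-cong {4} {Π} {1} {M * M} {1}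
          (eulerPart≡1%4 {t = t} Ps Qs eulerPart Ps-ok Qs-ok |Qs|≡2t unique Π≡) (square%4 1≤M M-primes))
  m≡1 : m % 4 ≡ 1
  m≡1 = trans (sym (%-*-≡1 {4} m B≡1)) (trans (cong (_% 4) m*B≡n) n≡1)
  m-primes : AllPrimeDivisors≡3%4 m
  m-primes = divisor-primeDivisors≡3%4 Ps Qs Ps-ok Qs-ok Π≡ M-primes gcd≡1
    (divides (2 ^ k) (trans (sym m*2^k≡σΠ) (*-comm m (2 ^ k))))
    (divides B (trans (sym n≡) (trans (sym m*B≡n) (*-comm m B))))
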